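{- For every positive integer $n$, $$p^{(3)}(n,2)=\sum_{i\ge 1}\hat{p}^{(1)}_i\!\left(n-\frac{i(i+1)}{2}\right),$$ where $p^{(3)}(n,2)$ is the number of partitions of $n$ with $3$-distant parts whose smallest part is at least $2$, and, for an integer $m$ and $i\ge1$, $\hat{p}^{(1)}_i(m)$ is the number of partitions of $m$ into exactly $i$ distinct parts whose smallest even part is greater than twice the number of odd parts (with $\hat{p}^{(1)}_i(m)=0$ for $m\le 0$).
   Context: A partition of $n$ is a non-increasing sequence of positive integers $\lambda_1\ge\cdots\ge\lambda_l$ summing to $n$; it has $d$-distant parts if $\lambda_j-\lambda_{j+1}\ge d$ for all $j<l$ (so $1$-distant means all parts are distinct). For a partition $\mu$ with distinct parts, $l_o(\mu)$ denotes its number of odd parts and $e(\mu)$ its smallest even part; the condition "smallest even part greater than twice the number of odd parts" means $e(\mu)>2l_o(\mu)$, and it is regarded as satisfied when $\mu$ has no even parts. -}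

module Defs where

open import Data.Nat using (ℕ; zero; suc; _+_; _*_; _≤_; _<_; _⊔_; _⊓_)
open import Data.Nat.DivMod using (_%_)
open import Data.List using (List; []; _∷_; length; map; upTo; filter)
open import Data.Nat.ListAction using (sum)
open import Data.List.Relation.Unary.All using (All)
open import Data.List.Relation.Unary.Linked using (Linked)
open import Data.Maybe using (Maybe; nothing; just)
open import Data.Product using (Σ; _×_)
open import Data.Unit using (⊤)
open import Relation.Binary.PropositionalEquality using (_≡_)
open import Relation.Nullary.Decidable using (¬?)
open import Data.Nat using (_≟_)

-- A partition, represented as a list λ₁ ∷ λ₂ ∷ … ∷ λₗ of positive parts
-- with consecutive parts d-distant: λⱼ ≥ λⱼ₊₁ + d.  (d = 0: ordinary
-- partition, d = 1: distinct parts.)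
DistantParts : ℕ → List ℕ → Set
DistantParts d μ = Linked (λ a b → b + d ≤ a) μ × All (λ x → 1 ≤ x) μ

P3 : ℕ → Set
P3 n = Σ (List ℕ) λ μ → DistantParts 3 μ × All (λ x → 2 ≤ x) μ × sum μ ≡ n

oddParts : List ℕ → List ℕ
oddParts μ = filter (λ x → ¬? (x % 2 ≟ 0)) μ

evenParts : List ℕ → List ℕ
evenParts μ = filter (λ x → x % 2 ≟ 0) μ

lo : List ℕ → ℕ
lo μ = length (oddParts μ)

minimum? : List ℕ → Maybe ℕ
minimum? [] = nothing
minimum? (x ∷ xs) with minimum? xs
... | nothing = just x
... | just m  = just (x ⊓ m)

e : List ℕ → Maybe ℕ
e μ = minimum? (evenParts μ)

EvenCond : List ℕ → Set
EvenCond μ with e μ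
... | nothing = ⊤
... | just m  = 2 * lo μ < m

-- Partitions counted by p̂^{(1)}_i(n ∸ i(i+1)/2): partitions μ with exactly
-- i distinct parts, satisfying EvenCond, with  |μ| + i(i+1)/2 = n.
-- (When i(i+1)/2 ≥ n this type is empty, matching p̂ = 0 for m ≤ 0.)
-- i(i+1)/2 = 0 + 1 + … + i
triangle : ℕ → ℕ
triangle i = sum (upTo (suc i))

PHat : ℕ → ℕ → Set
PHat i n = Σ (List ℕ) λ μ → DistantParts 1 μ × length μ ≡ i × EvenCond μ
             × sum μ + triangle i ≡ n

-- Sort both families by the number i of parts.  A 3-distant partition into i parts ≥ 2
-- minus the staircase (3i − 1, …, 5, 2) is an arbitrary nonincreasing sequence of i
-- naturals.  A partition counted by p̂⁽¹⁾_i with o odd parts 2b + 1 and j = i − o even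
-- parts 2c yields such a sequence too: the distinct b's minus (o − 1, …, 1, 0) become the
-- halves of its even entries, and the distinct c's, which all exceed o by the condition on
-- the smallest even part, minus (o + j, …, o + 2, o + 1) become the halves of its odd
-- entries.  Both constructions are invertible, and in both cases the entries sum to n minus
-- 2 + 5 + ⋯ + (3i − 1).  All families involved consist of strict partitions of n, so they
-- are finite, and summing over i gives the identity.

module Submission where

open import Defs
open import Data.Bool using (Bool; true; false)
open import Data.Fin using (Fin; zero; suc)
open import Data.Fin.Properties using (+↔⊎)
open import Data.List using (List; []; _∷_; _++_; length; map; upTo; applyUpTo; filter; merge)
open import Data.List.Membership.Propositional using (_∈_)
open import Data.List.Properties
  using (length-++; length-map; map-∘; map-id-local; upTo-∷ʳ; map-upTo;
         filter-all; filter-none; filter-accept; filter-reject)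
open import Data.List.Relation.Binary.Permutation.Propositional using (↭-sym)
open import Data.List.Relation.Binary.Permutation.Propositional.Properties
  using (merge-↭; ↭-length; All-resp-↭)
open import Data.List.Relation.Unary.All as All using (All; []; _∷_; all?)
import Data.List.Relation.Unary.All.Properties as All
open import Data.List.Relation.Unary.Any using (here; there)
open import Data.List.Relation.Unary.Linked as Linked using (Linked; []; [-]; _∷_; linked?)
import Data.List.Relation.Unary.Linked.Properties as Linked
open import Data.List.Relation.Unary.Linked.Properties using (Linked⇒All)
open import Data.Maybe using (just; nothing)
open import Data.Nat
  using (ℕ; zero; suc; _+_; _*_; _∸_; _≤_; _<_; z≤n; s≤s; s≤s⁻¹; _≟_; _≤?_; _<?_; _⊓_)
open import Data.Nat.DivMod
  using (_%_; _/_; m*n%n≡0; [m+kn]%n≡m%n; m*n/n≡m; +-distrib-/; m≡m%n+[m/n]*n; m%n<n)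
open import Data.Nat.ListAction using (sum)
open import Data.Nat.ListAction.Properties using (sum-↭; sum-++)
open import Data.Nat.Properties hiding (even≢odd)
open import Data.Nat.Tactic.RingSolver using (solve-∀)
open import Data.Product using (Σ; _×_; _,_; proj₁; proj₂)
open import Data.Product.Function.Dependent.Propositional using (Σ-↔)
open import Data.Product.Properties using (Σ-≡,≡→≡)
open import Data.Sum using (_⊎_; inj₁; inj₂)
open import Data.Sum.Function.Propositional using (_⊎-↔_)
open import Data.Unit using (tt)
open import Data.Vec using (Vec; []; _∷_)
open import Function using (_∘_)
open import Function.Bundles using (_↔_; mk↔ₛ′)
open import Function.Properties.Inverse using (↔-refl; ↔-sym; ↔-trans)
open import Level using (0ℓ)
open import Relation.Binary using (Rel)
import Relation.Binary as B
open import Relation.Binary.PropositionalEquality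
open import Relation.Nullary using (¬_; Dec; yes; no; does; contradiction; Irrelevant)
open import Relation.Nullary.Decidable using (¬?; _×-dec_)
open import Relation.Unary using (Pred; Decidable; ∁)
import Relation.Unary as U

-- Staircases

Gap : ℕ → ℕ → ℕ → Set
Gap d a b = b + d ≤ a

Distant : ℕ → List ℕ → Set
Distant d = Linked (Gap d)

gap-trans : ∀ {d a b c} → Gap d a b → Gap d b c → Gap d a c
gap-trans {d} {b = b} ab bc = ≤-trans bc (≤-trans (m≤m+n b d) ab)

distant-weaken : ∀ {d k xs} → Distant (d + k) xs → Distant d xs
distant-weaken {d} {k} = Linked.map (λ {_} {b} gap → ≤-trans (+-monoʳ-≤ b (m≤m+n d k)) gap)

tri : ℕ → ℕ
tri zero    = 0
tri (suc k) = k + tri k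

tri-+ : ∀ a b → tri (a + b) ≡ tri a + tri b + a * b
tri-+ zero    b = sym (+-identityʳ (tri b))
tri-+ (suc a) b rewrite tri-+ a b = regroup a b (tri a) (tri b)
  where
  regroup : ∀ a b s t → a + b + (s + t + a * b) ≡ a + s + t + (b + a * b)
  regroup = solve-∀

triangle≡ : ∀ i → triangle i ≡ i + tri i
triangle≡ zero    = refl
triangle≡ (suc i) = begin
  sum (upTo (suc (suc i)))          ≡⟨ cong sum (upTo-∷ʳ (suc i)) ⟨
  sum (upTo (suc i) ++ suc i ∷ [])  ≡⟨ sum-++ (upTo (suc i)) (suc i ∷ []) ⟩
  triangle i + (suc i + 0)          ≡⟨ cong₂ _+_ (triangle≡ i) (+-identityʳ (suc i)) ⟩
  i + tri i + suc i                 ≡⟨ regroup i (tri i) ⟩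
  suc i + (i + tri i)               ∎
  where
  open ≡-Reasoning
  regroup : ∀ i t → i + t + suc i ≡ suc i + (i + t)
  regroup = solve-∀

-- raise s d adds s + d·j to the part followed by j further parts; lower undoes it
-- (with truncated subtraction, so only on lists that staircase≤head applies to).
raise : ℕ → ℕ → List ℕ → List ℕ
raise s d []       = []
raise s d (y ∷ ys) = y + (s + d * length ys) ∷ raise s d ys

lower : ℕ → ℕ → List ℕ → List ℕ
lower s d []       = []
lower s d (x ∷ xs) = x ∸ (s + d * length xs) ∷ lower s d xs

length-raise : ∀ s d ys → length (raise s d ys) ≡ length ys
length-raise s d []       = refl
length-raise s d (y ∷ ys) = cong suc (length-raise s d ys)

length-lower : ∀ s d xs → length (lower s d xs) ≡ length xs
length-lower s d []       = refl
length-lower s d (x ∷ xs) = cong suc (length-lower s d xs)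

lower-raise : ∀ s d ys → lower s d (raise s d ys) ≡ ys
lower-raise s d []       = refl
lower-raise s d (y ∷ ys) rewrite length-raise s d ys =
  cong₂ _∷_ (m+n∸n≡m y (s + d * length ys)) (lower-raise s d ys)

staircase≤head : ∀ {s d x xs} → Distant d (x ∷ xs) → All (s ≤_) (x ∷ xs) →
                 s + d * length xs ≤ x
staircase≤head {s} {d} [-] (s≤x ∷ []) rewrite *-zeroʳ d | +-identityʳ s = s≤x
staircase≤head {s} {d} {xs = y ∷ ys} (gap ∷ gaps) (_ ∷ s≤ys) = begin
  s + d * suc (length ys)  ≡⟨ shift s d (length ys) ⟩
  s + d * length ys + d    ≤⟨ +-monoˡ-≤ d (staircase≤head gaps s≤ys) ⟩
  y + d                    ≤⟨ gap ⟩
  _                        ∎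
  where
  open ≤-Reasoning
  shift : ∀ s d l → s + d * suc l ≡ s + d * l + d
  shift = solve-∀

raise-lower : ∀ {s d xs} → Distant d xs → All (s ≤_) xs → raise s d (lower s d xs) ≡ xs
raise-lower {xs = []}     _    _              = refl
raise-lower {s} {d} {x ∷ xs} gaps (s≤x ∷ s≤xs) rewrite length-lower s d xs =
  cong₂ _∷_ (m∸n+n≡m (staircase≤head gaps (s≤x ∷ s≤xs))) (raise-lower (Linked.tail gaps) s≤xs)

-- raising widens each gap by exactly d
raise-gap : ∀ y y′ s d l k → (y′ + (s + d * l)) + (d + k) ≡ (y′ + k) + (s + d * suc l)
raise-gap = solve-∀

raise-distant : ∀ {k} s d {ys} → Distant k ys → Distant (d + k) (raise s d ys)
raise-distant s d []  = []
raise-distant s d [-] = [-]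
raise-distant {k} s d {y ∷ y′ ∷ ys} (gap ∷ gaps) =
  subst (_≤ y + (s + d * suc (length ys))) (sym (raise-gap y y′ s d (length ys) k))
    (+-monoˡ-≤ (s + d * suc (length ys)) gap)
  ∷ raise-distant s d gaps

raise-distant⁻ : ∀ {k} s d {ys} → Distant (d + k) (raise s d ys) → Distant k ys
raise-distant⁻ s d {[]}     _ = []
raise-distant⁻ s d {y ∷ []} _ = [-]
raise-distant⁻ {k} s d {y ∷ y′ ∷ ys} (gap ∷ gaps) =
  +-cancelʳ-≤ (s + d * suc (length ys)) (y′ + k) y
    (subst (_≤ y + (s + d * suc (length ys))) (raise-gap y y′ s d (length ys) k) gap)
  ∷ raise-distant⁻ s d gaps

lower-distant : ∀ {k} s d {xs} → Distant (d + k) xs → All (s ≤_) xs → Distant k (lower s d xs)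
lower-distant {k} s d gaps s≤xs =
  raise-distant⁻ s d (subst (Distant (d + k)) (sym (raise-lower (distant-weaken gaps) s≤xs)) gaps)

raise-≥ : ∀ s d ys → All (s ≤_) (raise s d ys)
raise-≥ s d []       = []
raise-≥ s d (y ∷ ys) = ≤-trans (m≤m+n s (d * length ys)) (m≤n+m _ y) ∷ raise-≥ s d ys

sum-raise : ∀ s d ys → sum (raise s d ys) ≡ sum ys + (s * length ys + d * tri (length ys))
sum-raise s d []       = sym (cong₂ _+_ (*-zeroʳ s) (*-zeroʳ d))
sum-raise s d (y ∷ ys) rewrite sum-raise s d ys = step y (sum ys) s d (length ys) (tri (length ys))
  where
  step : ∀ y S s d l t → y + (s + d * l) + (S + (s * l + d * t)) ≡ y + S + (s * suc l + d * (l + t))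
  step = solve-∀

sum-lower : ∀ {s d xs} → Distant d xs → All (s ≤_) xs →
            sum xs ≡ sum (lower s d xs) + (s * length xs + d * tri (length xs))
sum-lower {s} {d} {xs} dxs s≤xs = begin
  sum xs                                 ≡⟨ cong sum (raise-lower dxs s≤xs) ⟨
  sum (raise s d (lower s d xs))         ≡⟨ sum-raise s d (lower s d xs) ⟩
  sum (lower s d xs) + (s * length (lower s d xs) + d * tri (length (lower s d xs)))
    ≡⟨ cong (λ l → sum (lower s d xs) + (s * l + d * tri l)) (length-lower s d xs) ⟩
  sum (lower s d xs) + (s * length xs + d * tri (length xs)) ∎
  where open ≡-Reasoning

-- Merging sorted lists

module _ {A : Set} {R : Rel A 0ℓ} (R? : B.Decidable R) {P : Pred A 0ℓ} (P? : Decidable P) where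

  filter-mergeˡ : ∀ {xs ys} → All P xs → All (∁ P) ys → filter P? (merge R? xs ys) ≡ xs
  filter-mergeˡ {[]}     _          ¬pys = filter-none P? ¬pys
  filter-mergeˡ {x ∷ xs} {[]}       pxs _ = filter-all P? pxs
  filter-mergeˡ {x ∷ xs} {y ∷ ys}   (px ∷ pxs) (¬py ∷ ¬pys)
    with does (R? x y) | filter-mergeˡ pxs (¬py ∷ ¬pys) | filter-mergeˡ (px ∷ pxs) ¬pys
  ... | true  | rec | _   = trans (filter-accept P? px) (cong (x ∷_) rec)
  ... | false | _   | rec = trans (filter-reject P? ¬py) rec

  filter-mergeʳ : ∀ {xs ys} → All (∁ P) xs → All P ys → filter P? (merge R? xs ys) ≡ ys
  filter-mergeʳ {[]}     _ pys = filter-all P? pys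
  filter-mergeʳ {x ∷ xs} {[]}     ¬pxs _ = filter-none P? ¬pxs
  filter-mergeʳ {x ∷ xs} {y ∷ ys} (¬px ∷ ¬pxs) (py ∷ pys)
    with does (R? x y) | filter-mergeʳ ¬pxs (py ∷ pys) | filter-mergeʳ (¬px ∷ ¬pxs) pys
  ... | true  | rec | _   = trans (filter-reject P? ¬px) rec
  ... | false | _   | rec = trans (filter-accept P? py) (cong (y ∷_) rec)

module _ {A : Set} {R : Rel A 0ℓ} (R? : B.Decidable R) where

  length-merge : ∀ xs ys → length (merge R? xs ys) ≡ length xs + length ys
  length-merge xs ys = trans (↭-length (merge-↭ R? xs ys)) (length-++ xs)

  All-merge : ∀ {P : Pred A 0ℓ} {xs ys} → All P xs → All P ys → All P (merge R? xs ys)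
  All-merge {xs = xs} {ys} pxs pys = All-resp-↭ (↭-sym (merge-↭ R? xs ys)) (All.++⁺ pxs pys)

  merge-consˡ : ∀ {x} xs {ys} → All (R x) ys → merge R? (x ∷ xs) ys ≡ x ∷ merge R? xs ys
  merge-consˡ []       {[]}     []         = refl
  merge-consˡ (_ ∷ _)  {[]}     []         = refl
  merge-consˡ {x} xs   {y ∷ ys} (rxy ∷ _) with R? x y
  ... | yes _   = refl
  ... | no ¬rxy = contradiction rxy ¬rxy

  merge-consʳ : ∀ xs {y ys} → All (λ x → ¬ R x y) xs → merge R? xs (y ∷ ys) ≡ y ∷ merge R? xs ys
  merge-consʳ []       []           = refl
  merge-consʳ (x ∷ xs) {y} (¬rxy ∷ _) with R? x y
  ... | yes rxy = contradiction rxy ¬rxy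
  ... | no _    = refl

sum-merge : ∀ {R : Rel ℕ 0ℓ} (R? : B.Decidable R) xs ys → sum (merge R? xs ys) ≡ sum xs + sum ys
sum-merge R? xs ys = trans (sum-↭ (merge-↭ R? xs ys)) (sum-++ xs ys)

module _ {A : Set} {S : Rel A 0ℓ} (S-trans : B.Transitive S) where

  Linked-head : ∀ {x xs} → Linked S (x ∷ xs) → All (S x) xs
  Linked-head [-]          = []
  Linked-head (sxy ∷ sxs) = Linked⇒All S-trans sxy sxs

  Linked-cons : ∀ {x xs} → All (S x) xs → Linked S xs → Linked S (x ∷ xs)
  Linked-cons []        [] = [-]
  Linked-cons (sxy ∷ _) sxs = sxy ∷ sxs

  module _ {R : Rel A 0ℓ} (R? : B.Decidable R) {P Q : Pred A 0ℓ}
           (S-left  : ∀ {x y} → P x → Q y → R x y → S x y)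
           (S-right : ∀ {x y} → P x → Q y → ¬ R x y → S y x) where

    merge-linked : ∀ {xs ys} → All P xs → All Q ys → Linked S xs → Linked S ys →
                   Linked S (merge R? xs ys)
    merge-linked {[]}     _ _ _ sys = sys
    merge-linked {x ∷ xs} {[]} _ _ sxs _ = sxs
    merge-linked {x ∷ xs} {y ∷ ys} (px ∷ pxs) (qy ∷ qys) sxs sys
      with R? x y | merge-linked pxs (qy ∷ qys) (Linked.tail sxs) sys
                  | merge-linked (px ∷ pxs) qys sxs (Linked.tail sys)
    ... | yes rxy | rec | _ =
      Linked-cons (All-merge R? (Linked-head sxs) (sxy ∷ All.map (S-trans sxy) (Linked-head sys))) rec
      where sxy = S-left px qy rxy
    ... | no ¬rxy | _ | rec =
      Linked-cons (All-merge R? (syx ∷ All.map (S-trans syx) (Linked-head sxs)) (Linked-head sys)) rec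
      where syx = S-right px qy ¬rxy

-- Even and odd parts

Even : ℕ → Set
Even x = x % 2 ≡ 0

Odd : ℕ → Set
Odd x = ¬ Even x

even? : Decidable Even
even? x = x % 2 ≟ 0

even≢odd : ∀ {x y} → Even x → Odd y → x ≢ y
even≢odd ex oy refl = oy ex

gap-< : ∀ {d a b} → d ≤ 1 → b < a → Gap d a b
gap-< {d} {a} {b} d≤1 b<a = ≤-trans (+-monoʳ-≤ b d≤1) (subst (_≤ a) (+-comm 1 b) b<a)

merge≥ : List ℕ → List ℕ → List ℕ
merge≥ = merge _≥?_

merge≥-distant : ∀ {d} → d ≤ 1 → ∀ {xs ys} → All Even xs → All Odd ys →
                 Distant d xs → Distant d ys → Distant d (merge≥ xs ys)
merge≥-distant {d} d≤1 = merge-linked gap-trans _≥?_ left right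
  where
  left : ∀ {x y} → Even x → Odd y → y ≤ x → Gap d x y
  left ex oy y≤x = gap-< d≤1 (≤∧≢⇒< y≤x (λ y≡x → even≢odd ex oy (sym y≡x)))
  right : ∀ {x y} → Even x → Odd y → ¬ y ≤ x → Gap d y x
  right _ _ y≰x = gap-< d≤1 (≰⇒> y≰x)

merge≥-evenParts-oddParts : ∀ {xs} → Distant 0 xs → merge≥ (evenParts xs) (oddParts xs) ≡ xs
merge≥-evenParts-oddParts {[]}     _   = refl
merge≥-evenParts-oddParts {x ∷ xs} dxs = by-parity (even? x)
  where
  open ≡-Reasoning
  rest : merge≥ (evenParts xs) (oddParts xs) ≡ xs
  rest = merge≥-evenParts-oddParts (Linked.tail dxs)
  ≤x : All (_≤ x) xs
  ≤x = All.map (λ {y} gap → ≤-trans (m≤m+n y 0) gap) (Linked-head gap-trans dxs)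
  by-parity : Dec (Even x) → merge≥ (evenParts (x ∷ xs)) (oddParts (x ∷ xs)) ≡ x ∷ xs
  by-parity (yes ex) = begin
    merge≥ (evenParts (x ∷ xs)) (oddParts (x ∷ xs))
      ≡⟨ cong₂ merge≥ (filter-accept even? {x} {xs} ex)
                      (filter-reject (¬? ∘ even?) {x} {xs} (λ ¬ex → ¬ex ex)) ⟩
    merge≥ (x ∷ evenParts xs) (oddParts xs)
      ≡⟨ merge-consˡ _≥?_ (evenParts xs) (All.filter⁺ (¬? ∘ even?) ≤x) ⟩
    x ∷ merge≥ (evenParts xs) (oddParts xs)
      ≡⟨ cong (x ∷_) rest ⟩
    x ∷ xs ∎
  by-parity (no ox) = begin
    merge≥ (evenParts (x ∷ xs)) (oddParts (x ∷ xs))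
      ≡⟨ cong₂ merge≥ (filter-reject even? {x} {xs} ox) (filter-accept (¬? ∘ even?) {x} {xs} ox) ⟩
    merge≥ (evenParts xs) (x ∷ oddParts xs)
      ≡⟨ merge-consʳ _≥?_ (evenParts xs)
           (All.zipWith below (All.filter⁺ even? ≤x , All.all-filter even? xs)) ⟩
    x ∷ merge≥ (evenParts xs) (oddParts xs)
      ≡⟨ cong (x ∷_) rest ⟩
    x ∷ xs ∎
    where
    below : ∀ {y} → y ≤ x × Even y → ¬ x ≤ y
    below (y≤x , ey) = <⇒≱ (≤∧≢⇒< y≤x (even≢odd ey ox))

double : ℕ → ℕ
double b = b * 2

double+1 : ℕ → ℕ
double+1 b = suc (b * 2)

half : ℕ → ℕ
half x = x / 2

even-double : ∀ b → Even (double b)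
even-double b = m*n%n≡0 b 2

odd-double+1 : ∀ b → Odd (double+1 b)
odd-double+1 b ev with trans (sym ([m+kn]%n≡m%n 1 b 2)) ev
... | ()

half-double : ∀ b → half (double b) ≡ b
half-double b = m*n/n≡m b 2

half-double+1 : ∀ b → half (double+1 b) ≡ b
half-double+1 b = trans (+-distrib-/ 1 (b * 2) no-carry) (m*n/n≡m b 2)
  where
  no-carry : 1 % 2 + (b * 2) % 2 < 2
  no-carry = subst (λ r → 1 % 2 + r < 2) (sym (m*n%n≡0 b 2)) (s≤s (s≤s z≤n))

double-half : ∀ {x} → Even x → double (half x) ≡ x
double-half {x} ex = sym (trans (m≡m%n+[m/n]*n x 2) (cong (_+ x / 2 * 2) ex))

double+1-half : ∀ {x} → Odd x → double+1 (half x) ≡ x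
double+1-half {x} ox =
  sym (trans (m≡m%n+[m/n]*n x 2) (cong (_+ x / 2 * 2) (odd%2 (x % 2) (m%n<n x 2) ox)))
  where
  odd%2 : ∀ r → r < 2 → r ≢ 0 → r ≡ 1
  odd%2 zero          _               r≢0 = contradiction refl r≢0
  odd%2 (suc zero)    _               _   = refl
  odd%2 (suc (suc _)) (s≤s (s≤s ())) _

map-∘-id : ∀ {f g : ℕ → ℕ} {xs} → All (λ x → g (f x) ≡ x) xs → map g (map f xs) ≡ xs
map-∘-id {xs = xs} gf = trans (sym (map-∘ xs)) (map-id-local gf)

sum-map-double : ∀ bs → sum (map double bs) ≡ sum bs * 2
sum-map-double []       = refl
sum-map-double (b ∷ bs) =
  trans (cong (b * 2 +_) (sum-map-double bs)) (sym (*-distribʳ-+ 2 b (sum bs)))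

sum-map-double+1 : ∀ bs → sum (map double+1 bs) ≡ length bs + sum bs * 2
sum-map-double+1 []       = refl
sum-map-double+1 (b ∷ bs) =
  trans (cong (suc (b * 2) +_) (sum-map-double+1 bs)) (regroup b (length bs) (sum bs))
  where
  regroup : ∀ b l s → suc (b * 2) + (l + s * 2) ≡ suc (l + (b + s) * 2)
  regroup = solve-∀

gap-double : ∀ {d a b} → Gap d a b → Gap d (double a) (double b)
gap-double {d} {a} {b} gap = begin
  b * 2 + d        ≤⟨ +-monoʳ-≤ (b * 2) (m≤m*n d 2) ⟩
  b * 2 + d * 2    ≡⟨ *-distribʳ-+ 2 b d ⟨
  (b + d) * 2      ≤⟨ *-monoˡ-≤ 2 gap ⟩
  a * 2            ∎
  where open ≤-Reasoning

gap-double⁻ : ∀ {d a b} → d ≤ 1 → Gap d (double a) (double b) → Gap d a b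
gap-double⁻ {a = a} {b} z≤n gap =
  subst (_≤ a) (sym (+-identityʳ b)) (*-cancelʳ-≤ b a 2 (subst (_≤ a * 2) (+-identityʳ (b * 2)) gap))
gap-double⁻ {a = a} {b} (s≤s z≤n) gap =
  gap-< (s≤s z≤n) (*-cancelʳ-< 2 b a (subst (_≤ a * 2) (+-comm (b * 2) 1) gap))

distant-double : ∀ {d bs} → Distant d bs → Distant d (map double bs)
distant-double = Linked.map⁺ ∘ Linked.map (λ {a} {b} → gap-double {a = a} {b})

distant-double⁻ : ∀ {d bs} → d ≤ 1 → Distant d (map double bs) → Distant d bs
distant-double⁻ d≤1 = Linked.map (gap-double⁻ d≤1) ∘ Linked.map⁻

distant-double+1 : ∀ {d bs} → Distant d bs → Distant d (map double+1 bs)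
distant-double+1 = Linked.map⁺ ∘ Linked.map (λ {a} {b} → s≤s ∘ gap-double {a = a} {b})

distant-double+1⁻ : ∀ {d bs} → d ≤ 1 → Distant d (map double+1 bs) → Distant d bs
distant-double+1⁻ d≤1 = Linked.map (gap-double⁻ d≤1 ∘ s≤s⁻¹) ∘ Linked.map⁻

distant-half-even : ∀ {d xs} → d ≤ 1 → All Even xs → Distant d xs → Distant d (map half xs)
distant-half-even d≤1 exs dxs =
  distant-double⁻ d≤1 (subst (Distant _) (sym (map-∘-id (All.map double-half exs))) dxs)

distant-half-odd : ∀ {d xs} → d ≤ 1 → All Odd xs → Distant d xs → Distant d (map half xs)
distant-half-odd d≤1 oxs dxs =
  distant-double+1⁻ d≤1 (subst (Distant _) (sym (map-∘-id (All.map double+1-half oxs))) dxs)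

evenHalves : List ℕ → List ℕ
evenHalves μ = map half (evenParts μ)

oddHalves : List ℕ → List ℕ
oddHalves μ = map half (oddParts μ)

assemble : List ℕ → List ℕ → List ℕ
assemble cs bs = merge≥ (map double cs) (map double+1 bs)

module _ (cs bs : List ℕ) where

  private
    evens : All Even (map double cs)
    evens = All.map⁺ (All.universal even-double cs)

    odds : All Odd (map double+1 bs)
    odds = All.map⁺ (All.universal odd-double+1 bs)

  evenParts-assemble : evenParts (assemble cs bs) ≡ map double cs
  evenParts-assemble = filter-mergeˡ _≥?_ even? evens odds

  oddParts-assemble : oddParts (assemble cs bs) ≡ map double+1 bs
  oddParts-assemble = filter-mergeʳ _≥?_ (¬? ∘ even?) (All.map (λ ex ox → ox ex) evens) odds

  evenHalves-assemble : evenHalves (assemble cs bs) ≡ cs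
  evenHalves-assemble =
    trans (cong (map half) evenParts-assemble) (map-∘-id (All.universal half-double cs))

  oddHalves-assemble : oddHalves (assemble cs bs) ≡ bs
  oddHalves-assemble =
    trans (cong (map half) oddParts-assemble) (map-∘-id (All.universal half-double+1 bs))

  length-assemble : length (assemble cs bs) ≡ length cs + length bs
  length-assemble = trans (length-merge _≥?_ (map double cs) (map double+1 bs))
                          (cong₂ _+_ (length-map double cs) (length-map double+1 bs))

  sum-assemble : sum (assemble cs bs) ≡ sum cs * 2 + (length bs + sum bs * 2)
  sum-assemble = trans (sum-merge _≥?_ (map double cs) (map double+1 bs))
                       (cong₂ _+_ (sum-map-double cs) (sum-map-double+1 bs))

  distant-assemble : ∀ {d} → d ≤ 1 → Distant d cs → Distant d bs → Distant d (assemble cs bs)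
  distant-assemble d≤1 dcs dbs =
    merge≥-distant d≤1 evens odds (distant-double dcs) (distant-double+1 dbs)

assemble-halves : ∀ {μ} → Distant 0 μ → assemble (evenHalves μ) (oddHalves μ) ≡ μ
assemble-halves {μ} dμ = trans
  (cong₂ merge≥ (map-∘-id (All.map double-half (All.all-filter even? μ)))
                (map-∘-id (All.map double+1-half (All.all-filter (¬? ∘ even?) μ))))
  (merge≥-evenParts-oddParts dμ)

distant-evenHalves : ∀ {d μ} → d ≤ 1 → Distant d μ → Distant d (evenHalves μ)
distant-evenHalves {μ = μ} d≤1 dμ =
  distant-half-even d≤1 (All.all-filter even? μ) (Linked.filter⁺ even? gap-trans dμ)

distant-oddHalves : ∀ {d μ} → d ≤ 1 → Distant d μ → Distant d (oddHalves μ)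
distant-oddHalves {μ = μ} d≤1 dμ =
  distant-half-odd d≤1 (All.all-filter (¬? ∘ even?) μ) (Linked.filter⁺ (¬? ∘ even?) gap-trans dμ)

length-halves : ∀ {μ} → Distant 0 μ → length μ ≡ length (evenHalves μ) + length (oddHalves μ)
length-halves {μ} dμ =
  trans (cong length (sym (assemble-halves dμ))) (length-assemble (evenHalves μ) (oddHalves μ))

sum-halves : ∀ {μ} → Distant 0 μ →
             sum μ ≡ sum (evenHalves μ) * 2 + (length (oddHalves μ) + sum (oddHalves μ) * 2)
sum-halves {μ} dμ =
  trans (cong sum (sym (assemble-halves dμ))) (sum-assemble (evenHalves μ) (oddHalves μ))

minimum?-nothing : ∀ ys → minimum? ys ≡ nothing → ys ≡ []
minimum?-nothing []       _ = refl
minimum?-nothing (y ∷ ys) eq with minimum? ys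
minimum?-nothing (y ∷ ys) () | nothing
minimum?-nothing (y ∷ ys) () | just _

minimum?-just : ∀ ys {m} → minimum? ys ≡ just m → All (m ≤_) ys × m ∈ ys
minimum?-just (y ∷ ys) eq with minimum? ys in eq′
minimum?-just (y ∷ ys) refl | nothing rewrite minimum?-nothing ys eq′ = ≤-refl ∷ [] , here refl
minimum?-just (y ∷ ys) refl | just m with minimum?-just ys eq′
... | m≤ys , m∈ys = m⊓n≤m y m ∷ All.map (≤-trans (m⊓n≤n y m)) m≤ys , min∈
  where
  min∈ : y ⊓ m ∈ y ∷ ys
  min∈ with ⊓-sel y m
  ... | inj₁ y⊓m≡y = here y⊓m≡y
  ... | inj₂ y⊓m≡m = there (subst (_∈ ys) (sym y⊓m≡m) m∈ys)

EvenCond⇒All : ∀ μ → EvenCond μ → All (2 * lo μ <_) (evenParts μ)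
EvenCond⇒All μ cond with e μ in eq
... | nothing rewrite minimum?-nothing (evenParts μ) eq = []
... | just m  = All.map (<-≤-trans cond) (proj₁ (minimum?-just (evenParts μ) eq))

All⇒EvenCond : ∀ μ → All (2 * lo μ <_) (evenParts μ) → EvenCond μ
All⇒EvenCond μ bound with e μ in eq
... | nothing = tt
... | just m  = All.lookup bound (proj₂ (minimum?-just (evenParts μ) eq))

evenCond? : ∀ μ → Dec (EvenCond μ)
evenCond? μ with e μ
... | nothing = yes tt
... | just m  = 2 * lo μ <? m

EvenCond-irrelevant : ∀ μ → Irrelevant (EvenCond μ)
EvenCond-irrelevant μ with e μ
... | nothing = λ _ _ → refl
... | just m  = <-irrelevant

-- The common reduced form

-- 2 + 5 + ⋯ + (3i − 1), the least sum of i parts that are 3-distant and ≥ 2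
leastP3Sum : ℕ → ℕ
leastP3Sum i = 2 * i + 3 * tri i

Reduced : ℕ → ℕ → List ℕ → Set
Reduced i n l = Distant 0 l × length l ≡ i × sum l + leastP3Sum i ≡ n

toReduced : List ℕ → List ℕ
toReduced μ = assemble (lower 0 1 (oddHalves μ)) (lower (suc (length (oddHalves μ))) 1 (evenHalves μ))

fromReduced : List ℕ → List ℕ
fromReduced l = assemble (raise (suc (length (evenHalves l))) 1 (oddHalves l)) (raise 0 1 (evenHalves l))

half-bound : ∀ {o x} → Even x → 2 * o < x → suc o ≤ half x
half-bound {o} {x} ex 2o<x = subst (_≤ half x) (+-comm o 1)
  (gap-double⁻ (s≤s z≤n) (subst₂ _≤_ (trans (cong suc (*-comm 2 o)) (+-comm 1 (o * 2)))
                                      (sym (double-half ex)) 2o<x))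

double-bound : ∀ {o c} → suc o ≤ c → 2 * o < double c
double-bound {o} {c} o<c = begin-strict
  2 * o        ≡⟨ *-comm 2 o ⟩
  o * 2        <⟨ n<1+n (o * 2) ⟩
  suc (o * 2)  ≤⟨ n≤1+n _ ⟩
  suc o * 2    ≤⟨ *-monoˡ-≤ 2 o<c ⟩
  c * 2        ∎
  where open ≤-Reasoning

evenHalves-bound : ∀ μ → EvenCond μ → All (suc (length (oddHalves μ)) ≤_) (evenHalves μ)
evenHalves-bound μ cond =
  subst (λ o → All (suc o ≤_) (evenHalves μ)) (sym (length-map half (oddParts μ)))
    (All.map⁺ (All.zipWith (λ (ex , 2o<x) → half-bound ex 2o<x)
                           (All.all-filter even? μ , EvenCond⇒All μ cond)))

toReduced-distant : ∀ {μ} → Distant 1 μ → EvenCond μ → Distant 0 (toReduced μ)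
toReduced-distant {μ} dμ cond = distant-assemble _ _ z≤n
  (lower-distant 0 1 (distant-oddHalves (s≤s z≤n) dμ) (All.universal (λ _ → z≤n) _))
  (lower-distant _ 1 (distant-evenHalves (s≤s z≤n) dμ) (evenHalves-bound μ cond))

fromReduced-distant : ∀ {l} → Distant 0 l → Distant 1 (fromReduced l)
fromReduced-distant dl = distant-assemble _ _ (s≤s z≤n)
  (raise-distant _ 1 (distant-oddHalves z≤n dl)) (raise-distant 0 1 (distant-evenHalves z≤n dl))

fromReduced-positive : ∀ l → All (1 ≤_) (fromReduced l)
fromReduced-positive l = All-merge _≥?_
  (All.map⁺ (All.map (λ o<c → ≤-trans (s≤s z≤n) (double-bound o<c)) (raise-≥ _ 1 (oddHalves l))))
  (All.map⁺ (All.universal (λ _ → s≤s z≤n) _))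

fromReduced-evenCond : ∀ l → EvenCond (fromReduced l)
fromReduced-evenCond l = All⇒EvenCond (fromReduced l)
  (subst₂ (λ o es → All (2 * o <_) es) (sym odd-count) (sym (evenParts-assemble γ β))
          (All.map⁺ (All.map double-bound (raise-≥ _ 1 (oddHalves l)))))
  where
  β = raise 0 1 (evenHalves l)
  γ = raise (suc (length (evenHalves l))) 1 (oddHalves l)
  odd-count : lo (fromReduced l) ≡ length (evenHalves l)
  odd-count = begin
    length (oddParts (fromReduced l))  ≡⟨ cong length (oddParts-assemble γ β) ⟩
    length (map double+1 β)            ≡⟨ length-map double+1 β ⟩
    length β                           ≡⟨ length-raise 0 1 (evenHalves l) ⟩
    length (evenHalves l)              ∎
    where open ≡-Reasoning

fromReduced-toReduced : ∀ {μ} → Distant 1 μ → EvenCond μ → fromReduced (toReduced μ) ≡ μ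
fromReduced-toReduced {μ} dμ cond = begin
  fromReduced (toReduced μ)
    ≡⟨ cong₂ (λ cs bs → assemble (raise (suc (length cs)) 1 bs) (raise 0 1 cs))
             (evenHalves-assemble β γ) (oddHalves-assemble β γ) ⟩
  assemble (raise (suc (length β)) 1 γ) (raise 0 1 β)
    ≡⟨ cong (λ o → assemble (raise (suc o) 1 γ) (raise 0 1 β)) (length-lower 0 1 b) ⟩
  assemble (raise (suc (length b)) 1 γ) (raise 0 1 β)
    ≡⟨ cong₂ assemble (raise-lower (distant-evenHalves (s≤s z≤n) dμ) (evenHalves-bound μ cond))
                      (raise-lower (distant-oddHalves (s≤s z≤n) dμ) (All.universal (λ _ → z≤n) b)) ⟩
  assemble (evenHalves μ) b
    ≡⟨ assemble-halves (distant-weaken dμ) ⟩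
  μ ∎
  where
  open ≡-Reasoning
  b = oddHalves μ
  β = lower 0 1 b
  γ = lower (suc (length b)) 1 (evenHalves μ)

toReduced-fromReduced : ∀ {l} → Distant 0 l → toReduced (fromReduced l) ≡ l
toReduced-fromReduced {l} dl = begin
  toReduced (fromReduced l)
    ≡⟨ cong₂ (λ cs bs → assemble (lower 0 1 bs) (lower (suc (length bs)) 1 cs))
             (evenHalves-assemble γ β) (oddHalves-assemble γ β) ⟩
  assemble (lower 0 1 β) (lower (suc (length β)) 1 γ)
    ≡⟨ cong (λ j → assemble (lower 0 1 β) (lower (suc j) 1 γ)) (length-raise 0 1 (evenHalves l)) ⟩
  assemble (lower 0 1 β) (lower (suc (length (evenHalves l))) 1 γ)
    ≡⟨ cong₂ assemble (lower-raise 0 1 (evenHalves l)) (lower-raise _ 1 (oddHalves l)) ⟩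
  assemble (evenHalves l) (oddHalves l)
    ≡⟨ assemble-halves dl ⟩
  l ∎
  where
  open ≡-Reasoning
  β = raise 0 1 (evenHalves l)
  γ = raise (suc (length (evenHalves l))) 1 (oddHalves l)

length-toReduced : ∀ {μ} → Distant 0 μ → length (toReduced μ) ≡ length μ
length-toReduced {μ} dμ = begin
  length (toReduced μ)  ≡⟨ length-assemble β γ ⟩
  length β + length γ   ≡⟨ cong₂ _+_ (length-lower 0 1 b) (length-lower _ 1 c) ⟩
  length b + length c   ≡⟨ +-comm (length b) (length c) ⟩
  length c + length b   ≡⟨ length-halves dμ ⟨
  length μ              ∎
  where
  open ≡-Reasoning
  b = oddHalves μ
  c = evenHalves μ
  β = lower 0 1 b
  γ = lower (suc (length b)) 1 c

sum-toReduced : ∀ {μ i} → Distant 1 μ → EvenCond μ → length μ ≡ i →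
                sum (toReduced μ) + leastP3Sum i ≡ sum μ + triangle i
sum-toReduced {μ} dμ cond refl = begin
  sum (toReduced μ) + leastP3Sum (length μ)
    ≡⟨ cong₂ _+_ (sum-assemble β γ) (cong leastP3Sum parts) ⟩
  sum β * 2 + (length γ + sum γ * 2) + leastP3Sum (j + o)
    ≡⟨ cong (λ k → sum β * 2 + (k + sum γ * 2) + leastP3Sum (j + o)) (length-lower (suc o) 1 c) ⟩
  sum β * 2 + (j + sum γ * 2) + leastP3Sum (j + o)
    ≡⟨ rearrange (sum β) (sum γ) j o ⟩
  (sum γ + (suc o * j + 1 * tri j)) * 2 + (o + (sum β + (0 * o + 1 * tri o)) * 2) + triangle (j + o)
    ≡⟨ cong₂ (λ sc sb → sc * 2 + (o + sb * 2) + triangle (j + o))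
             (sum-lower (distant-evenHalves (s≤s z≤n) dμ) (evenHalves-bound μ cond))
             (sum-lower (distant-oddHalves (s≤s z≤n) dμ) (All.universal (λ _ → z≤n) b)) ⟨
  sum c * 2 + (o + sum b * 2) + triangle (j + o)
    ≡⟨ cong₂ _+_ (sum-halves (distant-weaken dμ)) (cong triangle parts) ⟨
  sum μ + triangle (length μ) ∎
  where
  open ≡-Reasoning
  b = oddHalves μ
  c = evenHalves μ
  o = length b
  j = length c
  β = lower 0 1 b
  γ = lower (suc o) 1 c
  parts : length μ ≡ j + o
  parts = length-halves (distant-weaken dμ)
  rearrange : ∀ sβ sγ j o → sβ * 2 + (j + sγ * 2) + leastP3Sum (j + o) ≡
              (sγ + (suc o * j + 1 * tri j)) * 2 + (o + (sβ + (0 * o + 1 * tri o)) * 2) + triangle (j + o)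
  rearrange sβ sγ j o rewrite triangle≡ (j + o) | tri-+ j o = ring sβ sγ j o (tri j) (tri o)
    where
    ring : ∀ sβ sγ j o s t → sβ * 2 + (j + sγ * 2) + (2 * (j + o) + 3 * (s + t + j * o)) ≡
           (sγ + (suc o * j + 1 * s)) * 2 + (o + (sβ + (0 * o + 1 * t)) * 2) + (j + o + (s + t + j * o))
    ring = solve-∀

×-irrelevant : ∀ {A B : Set} → Irrelevant A → Irrelevant B → Irrelevant (A × B)
×-irrelevant irrA irrB (a , b) (a′ , b′) = cong₂ _,_ (irrA a a′) (irrB b b′)

restrict-↔ : ∀ {A B : Set} {P : Pred A 0ℓ} {Q : Pred B 0ℓ} → U.Irrelevant P → U.Irrelevant Q →
             (f : A → B) (g : B → A) → (∀ {x} → P x → Q (f x)) → (∀ {y} → Q y → P (g y)) →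
             (∀ {x} → P x → g (f x) ≡ x) → (∀ {y} → Q y → f (g y) ≡ y) → Σ A P ↔ Σ B Q
restrict-↔ irrP irrQ f g f-maps g-maps g∘f f∘g = mk↔ₛ′
  (λ (x , p) → f x , f-maps p) (λ (y , q) → g y , g-maps q)
  (λ (y , q) → Σ-≡,≡→≡ (f∘g q , irrQ _ q)) (λ (x , p) → Σ-≡,≡→≡ (g∘f p , irrP _ p))

Σ↔Σ-fibres : ∀ {A : Set} {P : Pred A 0ℓ} (f : A → ℕ) →
             Σ A P ↔ Σ ℕ (λ i → Σ A (λ x → P x × f x ≡ i))
Σ↔Σ-fibres f = mk↔ₛ′ (λ (x , p) → f x , x , p , refl) (λ (_ , x , p , _) → x , p)
  (λ { (_ , _ , _ , refl) → refl }) (λ _ → refl)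

-- P3 n and PHat i n are, definitionally, Σ (List ℕ) (P3Parts n) and Σ (List ℕ) (PHatParts i n).
P3Parts : ℕ → List ℕ → Set
P3Parts n μ = DistantParts 3 μ × All (2 ≤_) μ × sum μ ≡ n

PHatParts : ℕ → ℕ → List ℕ → Set
PHatParts i n μ = DistantParts 1 μ × length μ ≡ i × EvenCond μ × sum μ + triangle i ≡ n

Distant-irrelevant : ∀ {d} → U.Irrelevant (Distant d)
Distant-irrelevant = Linked.irrelevant ≤-irrelevant

DistantParts-irrelevant : ∀ {d} → U.Irrelevant (DistantParts d)
DistantParts-irrelevant = ×-irrelevant Distant-irrelevant (All.irrelevant ≤-irrelevant)

P3Parts-irrelevant : ∀ {n} → U.Irrelevant (P3Parts n)
P3Parts-irrelevant =
  ×-irrelevant DistantParts-irrelevant (×-irrelevant (All.irrelevant ≤-irrelevant) ≡-irrelevant)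

PHatParts-irrelevant : ∀ {i n} → U.Irrelevant (PHatParts i n)
PHatParts-irrelevant {x = μ} = ×-irrelevant DistantParts-irrelevant
  (×-irrelevant ≡-irrelevant (×-irrelevant (EvenCond-irrelevant μ) ≡-irrelevant))

Reduced-irrelevant : ∀ {i n} → U.Irrelevant (Reduced i n)
Reduced-irrelevant = ×-irrelevant Distant-irrelevant (×-irrelevant ≡-irrelevant ≡-irrelevant)

P3-fibre↔Reduced : ∀ i n → Σ (List ℕ) (λ μ → P3Parts n μ × length μ ≡ i) ↔ Σ (List ℕ) (Reduced i n)
P3-fibre↔Reduced i n = restrict-↔ (×-irrelevant P3Parts-irrelevant ≡-irrelevant) Reduced-irrelevant
  (lower 2 3) (raise 2 3) to from
  (λ (((d3 , _) , 2≤μ , _) , _) → raise-lower d3 2≤μ) (λ {l} _ → lower-raise 2 3 l)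
  where
  to : ∀ {μ} → P3Parts n μ × length μ ≡ i → Reduced i n (lower 2 3 μ)
  to {μ} (((d3 , _) , 2≤μ , sμ) , len) = lower-distant 2 3 d3 2≤μ , trans (length-lower 2 3 μ) len ,
    (begin
      sum (lower 2 3 μ) + leastP3Sum i            ≡⟨ cong (λ k → sum (lower 2 3 μ) + leastP3Sum k) len ⟨
      sum (lower 2 3 μ) + leastP3Sum (length μ)   ≡⟨ sum-lower d3 2≤μ ⟨
      sum μ                                       ≡⟨ sμ ⟩
      n                                           ∎)
    where open ≡-Reasoning
  from : ∀ {l} → Reduced i n l → P3Parts n (raise 2 3 l) × length (raise 2 3 l) ≡ i
  from {l} (d0 , len , sl) =
    ((raise-distant 2 3 d0 , All.map (≤-trans (s≤s z≤n)) 2≤) , 2≤ ,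
     trans (sum-raise 2 3 l) (trans (cong (λ k → sum l + leastP3Sum k) len) sl)) ,
    trans (length-raise 2 3 l) len
    where
    2≤ : All (2 ≤_) (raise 2 3 l)
    2≤ = raise-≥ 2 3 l

PHat↔Reduced : ∀ i n → PHat i n ↔ Σ (List ℕ) (Reduced i n)
PHat↔Reduced i n = restrict-↔ PHatParts-irrelevant Reduced-irrelevant toReduced fromReduced to from
  (λ ((d1 , _) , _ , cond , _) → fromReduced-toReduced d1 cond) (λ (d0 , _) → toReduced-fromReduced d0)
  where
  to : ∀ {μ} → PHatParts i n μ → Reduced i n (toReduced μ)
  to ((d1 , _) , len , cond , sμ) = toReduced-distant d1 cond ,
    trans (length-toReduced (distant-weaken d1)) len , trans (sum-toReduced d1 cond len) sμ
  from : ∀ {l} → Reduced i n l → PHatParts i n (fromReduced l)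
  from {l} (d0 , len , sl) = (d1 , fromReduced-positive l) , len′ , cond ,
    trans (sym (sum-toReduced d1 cond len′))
          (trans (cong (λ l′ → sum l′ + leastP3Sum i) (toReduced-fromReduced d0)) sl)
    where
    d1 = fromReduced-distant d0
    cond = fromReduced-evenCond l
    len′ : length (fromReduced l) ≡ i
    len′ = trans (sym (length-toReduced (distant-weaken d1)))
                 (trans (cong length (toReduced-fromReduced d0)) len)

P3↔ΣPHat : ∀ n → P3 n ↔ Σ ℕ (λ i → PHat i n)
P3↔ΣPHat n = ↔-trans (Σ↔Σ-fibres length)
  (Σ-↔ ↔-refl (λ {i} → ↔-trans (P3-fibre↔Reduced i n) (↔-sym (PHat↔Reduced i n))))

-- Finiteness and counting

Finite : Set → Set
Finite A = Σ ℕ λ k → A ↔ Fin k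

finite-Dec : ∀ {A : Set} → Dec A → Irrelevant A → Finite A
finite-Dec (yes a) irr = 1 , mk↔ₛ′ (λ _ → zero) (λ _ → a) (λ { zero → refl }) (irr a)
finite-Dec (no ¬a) _   = 0 , mk↔ₛ′ (λ a → contradiction a ¬a) (λ ()) (λ ()) (λ a → contradiction a ¬a)

finite-⊎ : ∀ {A B : Set} → Finite A → Finite B → Finite (A ⊎ B)
finite-⊎ (k , A↔k) (m , B↔m) = k + m , ↔-trans (A↔k ⊎-↔ B↔m) (↔-sym +↔⊎)

Σ-Vec-Bool-suc : ∀ {n} (Q : Vec Bool (suc n) → Set) →
                 Σ (Vec Bool (suc n)) Q ↔ (Σ (Vec Bool n) (Q ∘ (true ∷_)) ⊎ Σ (Vec Bool n) (Q ∘ (false ∷_)))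
Σ-Vec-Bool-suc Q = mk↔ₛ′ to from (λ { (inj₁ _) → refl ; (inj₂ _) → refl })
                                 (λ { ((true ∷ _) , _) → refl ; ((false ∷ _) , _) → refl })
  where
  to : Σ (Vec Bool _) Q → _
  to ((true ∷ v) , q)  = inj₁ (v , q)
  to ((false ∷ v) , q) = inj₂ (v , q)
  from : _ → Σ (Vec Bool _) Q
  from (inj₁ (v , q)) = (true ∷ v) , q
  from (inj₂ (v , q)) = (false ∷ v) , q

finite-Σ-Vec-Bool : ∀ n (Q : Vec Bool n → Set) → Decidable Q → U.Irrelevant Q → Finite (Σ (Vec Bool n) Q)
finite-Σ-Vec-Bool zero Q Q? irr with finite-Dec (Q? []) irr
... | k , Q[]↔k = k , ↔-trans (mk↔ₛ′ (λ { ([] , q) → q }) ([] ,_) (λ _ → refl) (λ { ([] , _) → refl })) Q[]↔k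
finite-Σ-Vec-Bool (suc n) Q Q? irr with
  finite-⊎ (finite-Σ-Vec-Bool n (Q ∘ (true ∷_)) (Q? ∘ (true ∷_)) irr)
           (finite-Σ-Vec-Bool n (Q ∘ (false ∷_)) (Q? ∘ (false ∷_)) irr)
... | k , ⊎↔k = k , ↔-trans (Σ-Vec-Bool-suc Q) ⊎↔k

data Descending≤ : ℕ → List ℕ → Set where
  []  : ∀ {n} → Descending≤ n []
  _∷_ : ∀ {n m xs} → m < n → Descending≤ m xs → Descending≤ n (suc m ∷ xs)

Descending≤-weaken : ∀ {m n xs} → m ≤ n → Descending≤ m xs → Descending≤ n xs
Descending≤-weaken _   []            = []
Descending≤-weaken m≤n (k<m ∷ desc) = <-≤-trans k<m m≤n ∷ desc

-- A list in Descending≤ n is the set of positions of true in a Vec Bool n, read from n down.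
fromIndicator : ∀ n → Vec Bool n → List ℕ
fromIndicator zero    []          = []
fromIndicator (suc n) (true ∷ v)  = suc n ∷ fromIndicator n v
fromIndicator (suc n) (false ∷ v) = fromIndicator n v

toIndicator : ∀ n → List ℕ → Vec Bool n
toIndicator zero    _        = []
toIndicator (suc n) []       = false ∷ toIndicator n []
toIndicator (suc n) (x ∷ xs) with x ≟ suc n
... | yes _ = true ∷ toIndicator n xs
... | no _  = false ∷ toIndicator n (x ∷ xs)

fromIndicator-descending : ∀ n v → Descending≤ n (fromIndicator n v)
fromIndicator-descending zero    []          = []
fromIndicator-descending (suc n) (true ∷ v)  = ≤-refl ∷ fromIndicator-descending n v
fromIndicator-descending (suc n) (false ∷ v) = Descending≤-weaken (n≤1+n n) (fromIndicator-descending n v)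

fromIndicator-toIndicator : ∀ n {xs} → Descending≤ n xs → fromIndicator n (toIndicator n xs) ≡ xs
fromIndicator-toIndicator zero    []         = refl
fromIndicator-toIndicator (suc n) []         = fromIndicator-toIndicator n []
fromIndicator-toIndicator (suc n) {suc m ∷ xs} (m<n ∷ desc) with suc m ≟ suc n
... | yes m+1≡n+1 = cong₂ _∷_ (sym m+1≡n+1)
                      (fromIndicator-toIndicator n (subst (λ k → Descending≤ k xs) (suc-injective m+1≡n+1) desc))
... | no m+1≢n+1  = fromIndicator-toIndicator n (≤∧≢⇒< (s≤s⁻¹ m<n) (m+1≢n+1 ∘ cong suc) ∷ desc)

toIndicator-below : ∀ n {xs} → Descending≤ n xs → toIndicator (suc n) xs ≡ false ∷ toIndicator n xs
toIndicator-below n []                          = refl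
toIndicator-below n {suc m ∷ _} (m<n ∷ _) with suc m ≟ suc n
... | yes m+1≡n+1 = contradiction (suc-injective m+1≡n+1) (<⇒≢ m<n)
... | no _        = refl

toIndicator-fromIndicator : ∀ n v → toIndicator n (fromIndicator n v) ≡ v
toIndicator-fromIndicator zero    []          = refl
toIndicator-fromIndicator (suc n) (true ∷ v) with suc n ≟ suc n
... | yes _ = cong (true ∷_) (toIndicator-fromIndicator n v)
... | no n+1≢n+1 = contradiction refl n+1≢n+1
toIndicator-fromIndicator (suc n) (false ∷ v) =
  trans (toIndicator-below n (fromIndicator-descending n v)) (cong (false ∷_) (toIndicator-fromIndicator n v))

finite-Σ-Descending≤ : ∀ n (P : Pred (List ℕ) 0ℓ) → Decidable P → U.Irrelevant P →
                       (∀ {xs} → P xs → Descending≤ n xs) → Finite (Σ (List ℕ) P)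
finite-Σ-Descending≤ n P P? irr desc
  with finite-Σ-Vec-Bool n (P ∘ fromIndicator n) (P? ∘ fromIndicator n) irr
... | k , Σ↔k = k , ↔-trans (restrict-↔ irr irr (toIndicator n) (fromIndicator n) to (λ p → p) from∘to
                                         (λ {v} _ → toIndicator-fromIndicator n v))
                             Σ↔k
  where
  from∘to : ∀ {xs} → P xs → fromIndicator n (toIndicator n xs) ≡ xs
  from∘to p = fromIndicator-toIndicator n (desc p)
  to : ∀ {xs} → P xs → P (fromIndicator n (toIndicator n xs))
  to p = subst P (sym (from∘to p)) p

Σℕ↔⊎ : ∀ {Q : ℕ → Set} → Σ ℕ Q ↔ (Q 0 ⊎ Σ ℕ (Q ∘ suc))
Σℕ↔⊎ {Q} = mk↔ₛ′ to from (λ { (inj₁ _) → refl ; (inj₂ _) → refl })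
                          (λ { (zero , _) → refl ; (suc _ , _) → refl })
  where
  to : Σ ℕ Q → Q 0 ⊎ Σ ℕ (Q ∘ suc)
  to (zero , q)  = inj₁ q
  to (suc i , q) = inj₂ (i , q)
  from : Q 0 ⊎ Σ ℕ (Q ∘ suc) → Σ ℕ Q
  from (inj₁ q)       = zero , q
  from (inj₂ (i , q)) = suc i , q

Σℕ↔Σℕ-suc : ∀ {Q : ℕ → Set} → ¬ Q 0 → Σ ℕ Q ↔ Σ ℕ (Q ∘ suc)
Σℕ↔Σℕ-suc {Q} ¬Q0 = mk↔ₛ′ to (λ (i , q) → suc i , q) (λ _ → refl) from∘to
  where
  to : Σ ℕ Q → Σ ℕ (Q ∘ suc)
  to (zero , q)  = contradiction q ¬Q0
  to (suc i , q) = i , q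
  from∘to : ∀ x → (suc (proj₁ (to x)) , proj₂ (to x)) ≡ x
  from∘to (zero , q)  = contradiction q ¬Q0
  from∘to (suc _ , _) = refl

Σℕ↔Fin-sum : ∀ m {Q : ℕ → Set} {f : ℕ → ℕ} → (∀ i → Q i ↔ Fin (f i)) → (∀ i → Q i → i < m) →
              Σ ℕ Q ↔ Fin (sum (applyUpTo f m))
Σℕ↔Fin-sum zero    _    below =
  mk↔ₛ′ (λ (i , q) → contradiction (below i q) n≮0) (λ ()) (λ ()) (λ (i , q) → contradiction (below i q) n≮0)
Σℕ↔Fin-sum (suc m) Q↔f below = ↔-trans Σℕ↔⊎
  (↔-trans (Q↔f 0 ⊎-↔ Σℕ↔Fin-sum m (Q↔f ∘ suc) (λ i q → s≤s⁻¹ (below (suc i) q))) (↔-sym +↔⊎))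

PHatParts? : ∀ i n → Decidable (PHatParts i n)
PHatParts? i n μ = (linked? (λ a b → b + 1 ≤? a) μ ×-dec all? (1 ≤?_) μ) ×-dec
                   (length μ ≟ i ×-dec (evenCond? μ ×-dec (sum μ + triangle i ≟ n)))

≤-sum : ∀ xs → All (_≤ sum xs) xs
≤-sum []       = []
≤-sum (x ∷ xs) = m≤m+n x (sum xs) ∷ All.map (λ x′≤ → ≤-trans x′≤ (m≤n+m (sum xs) x)) (≤-sum xs)

descending≤ : ∀ {n xs} → Distant 1 xs → All (1 ≤_) xs → All (_≤ n) xs → Descending≤ n xs
descending≤ {xs = []}         _    _              _              = []
descending≤ {xs = suc m ∷ xs} dxs (_ ∷ positive) (m<n ∷ ≤n) =
  m<n ∷ descending≤ (Linked.tail dxs) positive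
          (All.map (λ {y} gap → s≤s⁻¹ (subst (_≤ suc m) (+-comm y 1) gap)) (Linked-head gap-trans dxs))

finite-PHat : ∀ i n → Finite (PHat i n)
finite-PHat i n = finite-Σ-Descending≤ n (PHatParts i n) (PHatParts? i n) PHatParts-irrelevant
  λ {μ} ((d1 , positive) , _ , _ , sμ) →
    descending≤ d1 positive (All.map (λ x≤ → ≤-trans x≤ (≤-trans (m≤m+n _ _) (≤-reflexive sμ))) (≤-sum μ))

PHat-zero : ∀ {n} → 1 ≤ n → ¬ PHat 0 n
PHat-zero () ([] , _ , _ , _ , refl)

PHat-suc-bound : ∀ n i → PHat (suc i) n → i < n
PHat-suc-bound n i (μ , _ , _ , _ , sμ) = begin-strict
  i                          <⟨ n<1+n i ⟩
  suc i                      ≤⟨ m≤m+n (suc i) (tri (suc i)) ⟩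
  suc i + tri (suc i)        ≡⟨ triangle≡ (suc i) ⟨
  triangle (suc i)           ≤⟨ m≤n+m _ (sum μ) ⟩
  sum μ + triangle (suc i)   ≡⟨ sμ ⟩
  n                          ∎
  where open ≤-Reasoning

corollary1 : (n : ℕ) → 1 ≤ n →
    Σ ℕ λ k → Σ (ℕ → ℕ) λ c →
    (P3 n ↔ Fin k) × ((i : ℕ) → PHat i n ↔ Fin (c i))
    × k ≡ sum (map (λ i → c (suc i)) (upTo n))
corollary1 n 1≤n = sum (map (c ∘ suc) (upTo n)) , c , P3↔ , (λ i → proj₂ (finite-PHat i n)) , refl
  where
  c : ℕ → ℕ
  c i = proj₁ (finite-PHat i n)
  P3↔ : P3 n ↔ Fin (sum (map (c ∘ suc) (upTo n)))
  P3↔ = ↔-trans (P3↔ΣPHat n) (↔-trans (Σℕ↔Σℕ-suc (PHat-zero 1≤n))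
          (subst (λ cs → Σ ℕ (λ i → PHat (suc i) n) ↔ Fin (sum cs)) (sym (map-upTo (c ∘ suc) n))
            (Σℕ↔Fin-sum n (λ i → proj₂ (finite-PHat (suc i) n)) (PHat-suc-bound n))))
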